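{- For all integers $n,p\geq 1$, \[ D_{\phi_n}(\phi_p)=\sum_{k=1}^{p-1}\binom{n+p-1-k}{p-k}\,[\phi_k,\phi_{n+p-k}] \] (the sum is empty when $p=1$).
   Context: Let $\mathcal L$ be the free Lie algebra over $\mathbb Q$ on two generators $a,b$, with Lie bracket $[\cdot,\cdot]$, and let $\mathrm{ad}_a(x)=[a,x]$. For $n\geq 1$ set $\phi_n=\frac{1}{(n-1)!}\mathrm{ad}_a^{\,n-1}(b)$ (so $\phi_1=b$, $\phi_2=[a,b]$). For $f\in\mathcal L$, $D_f$ denotes the unique derivation of $\mathcal L$ with $D_f(a)=[f,a]$ and $D_f(b)=0$. -}

module Defs where

open import Data.Nat using (ℕ; zero; suc; _∸_; _+_; _!)
open import Data.Nat.Properties using (_!≢0)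
open import Data.Nat.Combinatorics using (_C_)
open import Data.Integer using (+_)
open import Data.Rational using (ℚ; _/_; _*_) renaming (_+_ to _+ℚ_)
open import Data.Rational as Q using ()

infixl 6 _⊕_
infixr 7 _·_
infix 4 _≈_

data Term : Set where
  gen-a gen-b : Term
  𝟘 : Term
  _⊕_ : Term → Term → Term
  _·_ : ℚ → Term → Term
  ⁅_,_⁆ : Term → Term → Term

-- The congruence generated by the ℚ-vector-space axioms and the Lie algebra
-- axioms (bilinearity, alternating, Jacobi).  Term / _≈_ is the free Lie
-- algebra 𝓛 over ℚ on the two generators a, b.
data _≈_ : Term → Term → Set where
  ≈-refl  : ∀ {x} → x ≈ x
  ≈-sym   : ∀ {x y} → x ≈ y → y ≈ x
  ≈-trans : ∀ {x y z} → x ≈ y → y ≈ z → x ≈ z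
  ⊕-cong  : ∀ {x x' y y'} → x ≈ x' → y ≈ y' → x ⊕ y ≈ x' ⊕ y'
  ·-cong  : ∀ {r x x'} → x ≈ x' → r · x ≈ r · x'
  br-cong : ∀ {x x' y y'} → x ≈ x' → y ≈ y' → ⁅ x , y ⁆ ≈ ⁅ x' , y' ⁆
  ⊕-assoc : ∀ x y z → (x ⊕ y) ⊕ z ≈ x ⊕ (y ⊕ z)
  ⊕-comm  : ∀ x y → x ⊕ y ≈ y ⊕ x
  ⊕-idʳ   : ∀ x → x ⊕ 𝟘 ≈ x
  ⊕-invʳ  : ∀ x → x ⊕ (Q.- Q.1ℚ) · x ≈ 𝟘
  ·-distʳ : ∀ r s x → (r +ℚ s) · x ≈ r · x ⊕ s · x
  ·-distˡ : ∀ r x y → r · (x ⊕ y) ≈ r · x ⊕ r · y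
  ·-assoc : ∀ r s x → (r * s) · x ≈ r · (s · x)
  ·-one   : ∀ x → Q.1ℚ · x ≈ x
  br-⊕ˡ   : ∀ x y z → ⁅ x ⊕ y , z ⁆ ≈ ⁅ x , z ⁆ ⊕ ⁅ y , z ⁆
  br-⊕ʳ   : ∀ x y z → ⁅ x , y ⊕ z ⁆ ≈ ⁅ x , y ⁆ ⊕ ⁅ x , z ⁆
  br-·ˡ   : ∀ r x y → ⁅ r · x , y ⁆ ≈ r · ⁅ x , y ⁆
  br-·ʳ   : ∀ r x y → ⁅ x , r · y ⁆ ≈ r · ⁅ x , y ⁆
  br-alt  : ∀ x → ⁅ x , x ⁆ ≈ 𝟘
  jacobi  : ∀ x y z → ⁅ x , ⁅ y , z ⁆ ⁆ ⊕ ⁅ y , ⁅ z , x ⁆ ⁆ ⊕ ⁅ z , ⁅ x , y ⁆ ⁆ ≈ 𝟘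

adaPow : ℕ → Term → Term
adaPow zero    x = x
adaPow (suc k) x = ⁅ gen-a , adaPow k x ⁆

-- φ_n = (1/(n-1)!) ad_a^{n-1}(b)   (meaningful for n ≥ 1)
φ : ℕ → Term
φ n = ((+ 1 / ((n ∸ 1) !)) {{(n ∸ 1) !≢0}}) · adaPow (n ∸ 1) gen-b

-- D_f : the derivation with D_f(a) = [f,a], D_f(b) = 0, extended to terms
-- linearly and by the Leibniz rule (well defined on 𝓛).
D : Term → Term → Term
D f gen-a       = ⁅ f , gen-a ⁆
D f gen-b       = 𝟘
D f 𝟘           = 𝟘
D f (x ⊕ y)     = D f x ⊕ D f y
D f (r · x)     = r · D f x
D f ⁅ x , y ⁆   = ⁅ D f x , y ⁆ ⊕ ⁅ x , D f y ⁆

ℕ→ℚ : ℕ → ℚ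
ℕ→ℚ m = + m / 1

Σ1 : ℕ → (ℕ → Term) → Term
Σ1 zero    t = 𝟘
Σ1 (suc m) t = Σ1 m t ⊕ t (suc m)

{-# OPTIONS --safe #-}
module Submission where

-- Write ψ m = ad_a^m b.  Since D_f [a , x] = [[f , a] , x] + [a , D_f x] and
-- [[ψ N , a] , ψ P] = [ψ P , ψ (N + 1)], induction on P with Pascal's rule gives
-- the Leibniz-type formula D_{ψ N} (ψ P) = Σ_{j<P} C(P,j) [ψ j , ψ (N + P - j)].
-- Dividing by N! P! and using C(P,j) / (P! N!) = C(N+P-j, P-j) / (j! (N+P-j)!)
-- turns it into the formula for φ_{N+1} and φ_{P+1}.

open import Defs
open import Data.Nat using (ℕ; _≤_; _+_; _∸_)
open import Data.Nat.Combinatorics using (_C_)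

open import Level using (0ℓ)
open import Algebra.Bundles using (AbelianGroup)
open import Data.Product using (_,_)
open import Data.Nat using (zero; suc; _*_; _<_; _!; s≤s; z≤n; NonZero)
open import Data.Nat.Properties
  using (+-suc; +-∸-assoc; m+n∸n≡m; ≤-refl; ≤-trans; m≤n+m; <⇒≤; m<n⇒m<1+n; m*n≢0; _!≢0; _!*_!≢0; *-identityʳ)
open import Data.Nat.Combinatorics
  using (nCk≡n!/k![n-k]!; k![n∸k]!∣n!; nCn≡1; nCk+nC[k+1]≡[n+1]C[k+1])
open import Data.Nat.DivMod using (m/n*n≡m)
open import Data.Nat.Tactic.RingSolver using (solve-∀)
open import Data.Integer as ℤ using (+_)
open import Data.Integer.Properties using (pos-+; pos-*)
open import Data.Rational as ℚ using (ℚ; _/_; toℚᵘ)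
import Data.Rational.Properties as ℚₚ
import Data.Rational.Unnormalised.Base as ℚᵘ
import Data.Rational.Unnormalised.Properties as ℚᵘₚ
open import Relation.Binary.PropositionalEquality
  using (_≡_; refl; sym; trans; cong; cong₂; subst; module ≡-Reasoning)

nCk*k![n∸k]!≡n! : ∀ {n k} → k ≤ n → (n C k) * (k ! * (n ∸ k) !) ≡ n !
nCk*k![n∸k]!≡n! {n} {k} k≤n = trans (cong (_* (k ! * (n ∸ k) !)) (nCk≡n!/k![n-k]! k≤n))
                                     (m/n*n≡m {{k !* (n ∸ k) !≢0}} (k![n∸k]!∣n! k≤n))

binomial-factorial-exchange : ∀ N {P j} → j ≤ P →
  (P C j) * (j ! * (N + P ∸ j) !) ≡ ((N + P ∸ j) C (P ∸ j)) * (P ! * N !)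
binomial-factorial-exchange N {P} {j} j≤P rewrite +-∸-assoc N j≤P = begin
  (P C j) * (j ! * (N + q) !)            ≡⟨ cong (λ t → (P C j) * (j ! * t)) (sym [N+q]!) ⟩
  (P C j) * (j ! * (x * (q ! * N !)))    ≡⟨ rearrange (P C j) (j !) x (q !) (N !) ⟩
  x * ((P C j) * (j ! * q !) * N !)      ≡⟨ cong (λ t → x * (t * N !)) (nCk*k![n∸k]!≡n! j≤P) ⟩
  x * (P ! * N !)                        ∎
  where
  open ≡-Reasoning
  q = P ∸ j
  x = (N + q) C q
  [N+q]! : x * (q ! * N !) ≡ (N + q) !
  [N+q]! = subst (λ r → x * (q ! * r !) ≡ (N + q) !) (m+n∸n≡m N q) (nCk*k![n∸k]!≡n! (m≤n+m q N))
  rearrange : ∀ a b c d e → a * (b * (c * (d * e))) ≡ c * (a * (b * d) * e)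
  rearrange = solve-∀

+-suc-∸ : ∀ m n {j} → j ≤ n → m + suc n ∸ j ≡ suc (m + n ∸ j)
+-suc-∸ m n {j} j≤n = trans (cong (_∸ j) (+-suc m n)) (+-∸-assoc 1 (≤-trans j≤n (m≤n+m n m)))

toℚᵘ-/ : ∀ i d .{{_ : NonZero d}} → toℚᵘ (i / d) ℚᵘ.≃ i ℚᵘ./ d
toℚᵘ-/ i (suc d) = ℚₚ.toℚᵘ-fromℚᵘ (ℚᵘ.mkℚᵘ i d)

/-cross : ∀ a b c d .{{_ : NonZero b}} .{{_ : NonZero d}} → a * d ≡ c * b → + a / b ≡ + c / d
/-cross a (suc b) c (suc d) ad≡cb = ℚₚ.fromℚᵘ-cong {ℚᵘ.mkℚᵘ (+ a) b} {ℚᵘ.mkℚᵘ (+ c) d}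
  (ℚᵘ.*≡* (trans (sym (pos-* a (suc d))) (trans (cong +_ ad≡cb) (pos-* c (suc b)))))

/-+-/ : ∀ a b c d .{{_ : NonZero b}} .{{_ : NonZero d}} →
        (+ a / b) ℚ.+ (+ c / d) ≡ (+ (a * d + c * b) / (b * d)) {{m*n≢0 b d}}
/-+-/ a b@(suc _) c d@(suc _) = ℚₚ.toℚᵘ-injective (begin
  toℚᵘ (+ a / b ℚ.+ + c / d)                 ≈⟨ ℚₚ.toℚᵘ-homo-+ (+ a / b) (+ c / d) ⟩
  toℚᵘ (+ a / b) ℚᵘ.+ toℚᵘ (+ c / d)         ≈⟨ ℚᵘₚ.+-cong (toℚᵘ-/ (+ a) b) (toℚᵘ-/ (+ c) d) ⟩
  (+ a ℤ.* + d ℤ.+ + c ℤ.* + b) ℚᵘ./ (b * d) ≡⟨ ℚᵘₚ./-cong numerator refl ⟩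
  + (a * d + c * b) ℚᵘ./ (b * d)             ≈⟨ toℚᵘ-/ (+ (a * d + c * b)) (b * d) ⟨
  toℚᵘ (+ (a * d + c * b) / (b * d))         ∎)
  where
  open ℚᵘₚ.≃-Reasoning
  numerator : + a ℤ.* + d ℤ.+ + c ℤ.* + b ≡ + (a * d + c * b)
  numerator = sym (trans (pos-+ (a * d) (c * b)) (cong₂ ℤ._+_ (pos-* a d) (pos-* c b)))

/-*-/ : ∀ a b c d .{{_ : NonZero b}} .{{_ : NonZero d}} →
        (+ a / b) ℚ.* (+ c / d) ≡ (+ (a * c) / (b * d)) {{m*n≢0 b d}}
/-*-/ a b@(suc _) c d@(suc _) = ℚₚ.toℚᵘ-injective (begin
  toℚᵘ ((+ a / b) ℚ.* (+ c / d))      ≈⟨ ℚₚ.toℚᵘ-homo-* (+ a / b) (+ c / d) ⟩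
  toℚᵘ (+ a / b) ℚᵘ.* toℚᵘ (+ c / d)  ≈⟨ ℚᵘₚ.*-cong (toℚᵘ-/ (+ a) b) (toℚᵘ-/ (+ c) d) ⟩
  (+ a ℤ.* + c) ℚᵘ./ (b * d)          ≡⟨ ℚᵘₚ./-cong (sym (pos-* a c)) refl ⟩
  + (a * c) ℚᵘ./ (b * d)              ≈⟨ toℚᵘ-/ (+ (a * c)) (b * d) ⟨
  toℚᵘ (+ (a * c) / (b * d))          ∎)
  where open ℚᵘₚ.≃-Reasoning

ℕ→ℚ-+ : ∀ m n → ℕ→ℚ (m + n) ≡ ℕ→ℚ m ℚ.+ ℕ→ℚ n
ℕ→ℚ-+ m n = sym (trans (/-+-/ m 1 n 1) (ℚₚ./-cong (cong +_ (cong₂ _+_ (*-identityʳ m) (*-identityʳ n))) refl))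

/-exchange : ∀ x y b d b′ d′ .{{_ : NonZero b}} .{{_ : NonZero d}} .{{_ : NonZero b′}} .{{_ : NonZero d′}} →
             x * (b′ * d′) ≡ y * (b * d) →
             (+ 1 / b) ℚ.* ((+ 1 / d) ℚ.* ℕ→ℚ x) ≡ ℕ→ℚ y ℚ.* ((+ 1 / b′) ℚ.* (+ 1 / d′))
/-exchange x y b@(suc _) d@(suc _) b′@(suc _) d′@(suc _) eq = begin
  (+ 1 / b) ℚ.* ((+ 1 / d) ℚ.* (+ x / 1))      ≡⟨ cong ((+ 1 / b) ℚ.*_) (/-*-/ 1 d x 1) ⟩
  (+ 1 / b) ℚ.* (+ (1 * x) / (d * 1))         ≡⟨ /-*-/ 1 b (1 * x) (d * 1) ⟩
  + (1 * (1 * x)) / (b * (d * 1))             ≡⟨ /-cross (1 * (1 * x)) (b * (d * 1)) (y * (1 * 1)) (1 * (b′ * d′)) cross ⟩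
  + (y * (1 * 1)) / (1 * (b′ * d′))           ≡⟨ /-*-/ y 1 (1 * 1) (b′ * d′) ⟨
  (+ y / 1) ℚ.* (+ (1 * 1) / (b′ * d′))       ≡⟨ cong ((+ y / 1) ℚ.*_) (/-*-/ 1 b′ 1 d′) ⟨
  (+ y / 1) ℚ.* ((+ 1 / b′) ℚ.* (+ 1 / d′))   ∎
  where
  open ≡-Reasoning
  lhs-nf : ∀ x a b → 1 * (1 * x) * (1 * (a * b)) ≡ x * (a * b)
  lhs-nf = solve-∀
  rhs-nf : ∀ y a b → y * (1 * 1) * (a * (b * 1)) ≡ y * (a * b)
  rhs-nf = solve-∀
  cross : 1 * (1 * x) * (1 * (b′ * d′)) ≡ y * (1 * 1) * (b * (d * 1))
  cross = trans (lhs-nf x b′ d′) (trans eq (sym (rhs-nf y b d)))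

infix 8 -_

-_ : Term → Term
- x = (ℚ.- ℚ.1ℚ) · x

⊕-abelianGroup : AbelianGroup 0ℓ 0ℓ
⊕-abelianGroup = record
  { Carrier        = Term
  ; _≈_            = _≈_
  ; _∙_            = _⊕_
  ; ε              = 𝟘
  ; _⁻¹            = -_
  ; isAbelianGroup = record
    { isGroup = record
      { isMonoid = record
        { isSemigroup = record
          { isMagma = record
            { isEquivalence = record { refl = ≈-refl ; sym = ≈-sym ; trans = ≈-trans }
            ; ∙-cong        = ⊕-cong
            }
          ; assoc = ⊕-assoc
          }
        ; identity = (λ x → ≈-trans (⊕-comm 𝟘 x) (⊕-idʳ x)) , ⊕-idʳ
        }
      ; inverse = (λ x → ≈-trans (⊕-comm (- x) x) (⊕-invʳ x)) , ⊕-invʳ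
      ; ⁻¹-cong = ·-cong
      }
    ; comm = ⊕-comm
    }
  }

open AbelianGroup ⊕-abelianGroup using (setoid; reflexive; identityˡ; group; commutativeSemigroup)
open import Algebra.Properties.Group group using (inverseˡ-unique; identityˡ-unique)
open import Algebra.Properties.CommutativeSemigroup commutativeSemigroup using (x∙yz≈y∙xz; interchange)
open import Relation.Binary.Reasoning.Setoid setoid

·-comm : ∀ r s x → r · (s · x) ≈ s · (r · x)
·-comm r s x = begin
  r · (s · x)      ≈⟨ ·-assoc r s x ⟨
  (r ℚ.* s) · x    ≡⟨ cong (_· x) (ℚₚ.*-comm r s) ⟩
  (s ℚ.* r) · x    ≈⟨ ·-assoc s r x ⟩
  s · (r · x)      ∎

br-·ˡʳ : ∀ r s x y → ⁅ r · x , s · y ⁆ ≈ (r ℚ.* s) · ⁅ x , y ⁆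
br-·ˡʳ r s x y = begin
  ⁅ r · x , s · y ⁆      ≈⟨ br-·ˡ r x (s · y) ⟩
  r · ⁅ x , s · y ⁆      ≈⟨ ·-cong (br-·ʳ s x y) ⟩
  r · (s · ⁅ x , y ⁆)    ≈⟨ ·-assoc r s ⁅ x , y ⁆ ⟨
  (r ℚ.* s) · ⁅ x , y ⁆  ∎

br-antisym : ∀ x y → ⁅ x , y ⁆ ≈ - ⁅ y , x ⁆
br-antisym x y = inverseˡ-unique ⁅ x , y ⁆ ⁅ y , x ⁆ (≈-sym (begin
  𝟘                                                   ≈⟨ br-alt (x ⊕ y) ⟨
  ⁅ x ⊕ y , x ⊕ y ⁆                                   ≈⟨ br-⊕ˡ x y (x ⊕ y) ⟩
  ⁅ x , x ⊕ y ⁆ ⊕ ⁅ y , x ⊕ y ⁆                       ≈⟨ ⊕-cong (br-⊕ʳ x x y) (br-⊕ʳ y x y) ⟩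
  (⁅ x , x ⁆ ⊕ ⁅ x , y ⁆) ⊕ (⁅ y , x ⁆ ⊕ ⁅ y , y ⁆) ≈⟨ ⊕-cong (⊕-cong (br-alt x) ≈-refl) (⊕-cong ≈-refl (br-alt y)) ⟩
  (𝟘 ⊕ ⁅ x , y ⁆) ⊕ (⁅ y , x ⁆ ⊕ 𝟘)                 ≈⟨ ⊕-cong (identityˡ _) (⊕-idʳ _) ⟩
  ⁅ x , y ⁆ ⊕ ⁅ y , x ⁆                               ∎))

⁅⁅x,y⁆,z⁆≈⁅z,⁅y,x⁆⁆ : ∀ x y z → ⁅ ⁅ x , y ⁆ , z ⁆ ≈ ⁅ z , ⁅ y , x ⁆ ⁆
⁅⁅x,y⁆,z⁆≈⁅z,⁅y,x⁆⁆ x y z = begin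
  ⁅ ⁅ x , y ⁆ , z ⁆     ≈⟨ br-antisym ⁅ x , y ⁆ z ⟩
  - ⁅ z , ⁅ x , y ⁆ ⁆   ≈⟨ br-·ʳ _ z ⁅ x , y ⁆ ⟨
  ⁅ z , - ⁅ x , y ⁆ ⁆   ≈⟨ br-cong ≈-refl (br-antisym y x) ⟨
  ⁅ z , ⁅ y , x ⁆ ⁆     ∎

br-leibniz : ∀ x y z → ⁅ x , ⁅ y , z ⁆ ⁆ ≈ ⁅ ⁅ x , y ⁆ , z ⁆ ⊕ ⁅ y , ⁅ x , z ⁆ ⁆
br-leibniz x y z = begin
  ⁅ x , ⁅ y , z ⁆ ⁆                          ≈⟨ inverseˡ-unique _ _ (≈-trans (≈-sym (⊕-assoc _ _ _)) (jacobi x y z)) ⟩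
  - (⁅ y , ⁅ z , x ⁆ ⁆ ⊕ ⁅ z , ⁅ x , y ⁆ ⁆)   ≈⟨ ·-distˡ _ _ _ ⟩
  - ⁅ y , ⁅ z , x ⁆ ⁆ ⊕ - ⁅ z , ⁅ x , y ⁆ ⁆   ≈⟨ ⊕-cong (br-·ʳ _ y ⁅ z , x ⁆) (br-antisym ⁅ x , y ⁆ z) ⟨
  ⁅ y , - ⁅ z , x ⁆ ⁆ ⊕ ⁅ ⁅ x , y ⁆ , z ⁆     ≈⟨ ⊕-cong (br-cong ≈-refl (br-antisym x z)) ≈-refl ⟨
  ⁅ y , ⁅ x , z ⁆ ⁆ ⊕ ⁅ ⁅ x , y ⁆ , z ⁆       ≈⟨ ⊕-comm _ _ ⟩
  ⁅ ⁅ x , y ⁆ , z ⁆ ⊕ ⁅ y , ⁅ x , z ⁆ ⁆       ∎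

infix 6.5 ∑<
∑< : ℕ → (ℕ → Term) → Term
∑< zero    f = 𝟘
∑< (suc m) f = ∑< m f ⊕ f m

syntax ∑< m (λ j → t) = ∑[ j < m ] t

Σ1≡∑ : ∀ m t → Σ1 m t ≡ ∑[ j < m ] t (suc j)
Σ1≡∑ zero    t = refl
Σ1≡∑ (suc m) t = cong (_⊕ t (suc m)) (Σ1≡∑ m t)

∑-cong : ∀ m {f g} → (∀ j → j < m → f j ≈ g j) → ∑< m f ≈ ∑< m g
∑-cong zero    f≈g = ≈-refl
∑-cong (suc m) f≈g = ⊕-cong (∑-cong m (λ j j<m → f≈g j (m<n⇒m<1+n j<m))) (f≈g m ≤-refl)

∑-distrib-⊕ : ∀ m f g → ∑[ j < m ] (f j ⊕ g j) ≈ ∑< m f ⊕ ∑< m g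
∑-distrib-⊕ zero    f g = ≈-sym (⊕-idʳ 𝟘)
∑-distrib-⊕ (suc m) f g = ≈-trans (⊕-cong (∑-distrib-⊕ m f g) ≈-refl) (interchange _ _ _ _)

∑-head-tail : ∀ m f → ∑< (suc m) f ≈ f 0 ⊕ ∑[ j < m ] f (suc j)
∑-head-tail zero    f = ≈-trans (identityˡ _) (≈-sym (⊕-idʳ _))
∑-head-tail (suc m) f = ≈-trans (⊕-cong (∑-head-tail m f) ≈-refl) (⊕-assoc _ _ _)

module _ {h : Term → Term} (h-cong : ∀ {x y} → x ≈ y → h x ≈ h y)
         (h-⊕ : ∀ x y → h (x ⊕ y) ≈ h x ⊕ h y) where

  additive⇒𝟘 : h 𝟘 ≈ 𝟘
  additive⇒𝟘 = identityˡ-unique (h 𝟘) (h 𝟘) (≈-trans (≈-sym (h-⊕ 𝟘 𝟘)) (h-cong (⊕-idʳ 𝟘)))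

  additive⇒∑ : ∀ m f → h (∑< m f) ≈ ∑[ j < m ] h (f j)
  additive⇒∑ zero    f = additive⇒𝟘
  additive⇒∑ (suc m) f = ≈-trans (h-⊕ _ _) (⊕-cong (additive⇒∑ m f) ≈-refl)

·-𝟘 : ∀ r → r · 𝟘 ≈ 𝟘
·-𝟘 r = additive⇒𝟘 {r ·_} ·-cong (·-distˡ r)

·-∑ : ∀ r m f → r · ∑< m f ≈ ∑[ j < m ] r · f j
·-∑ r = additive⇒∑ {r ·_} ·-cong (·-distˡ r)

br-∑ : ∀ z m f → ⁅ z , ∑< m f ⁆ ≈ ∑[ j < m ] ⁅ z , f j ⁆
br-∑ z = additive⇒∑ {⁅ z ,_⁆} (br-cong ≈-refl) (br-⊕ʳ z)

∑-pascal : ∀ n (v : ℕ → Term) →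
  ∑[ j < n ] ℕ→ℚ (n C j) · (v (suc j) ⊕ v j) ⊕ v n ≈ ∑[ j < suc n ] ℕ→ℚ (suc n C j) · v j
∑-pascal n v = begin
  ∑[ j < n ] ℕ→ℚ (n C j) · (v (suc j) ⊕ v j) ⊕ v n
    ≈⟨ ⊕-cong (≈-trans (∑-cong n (λ j _ → ·-distˡ _ _ _)) (∑-distrib-⊕ n _ _)) ≈-refl ⟩
  (shifted ⊕ ∑[ j < n ] ℕ→ℚ (n C j) · v j) ⊕ v n
    ≈⟨ ⊕-assoc _ _ _ ⟩
  shifted ⊕ (∑[ j < n ] ℕ→ℚ (n C j) · v j ⊕ v n)
    ≈⟨ ⊕-cong ≈-refl (⊕-cong ≈-refl (≈-sym [nCn]·vn≈vn)) ⟩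
  shifted ⊕ ∑[ j < suc n ] ℕ→ℚ (n C j) · v j
    ≈⟨ ⊕-cong ≈-refl (∑-head-tail n _) ⟩
  shifted ⊕ (ℕ→ℚ 1 · v 0 ⊕ unshifted)
    ≈⟨ x∙yz≈y∙xz _ _ _ ⟩
  ℕ→ℚ 1 · v 0 ⊕ (shifted ⊕ unshifted)
    ≈⟨ ⊕-cong ≈-refl (≈-sym (≈-trans (∑-cong n pascal) (∑-distrib-⊕ n _ _))) ⟩
  ℕ→ℚ 1 · v 0 ⊕ ∑[ j < n ] ℕ→ℚ (suc n C suc j) · v (suc j)
    ≈⟨ ∑-head-tail n _ ⟨
  ∑[ j < suc n ] ℕ→ℚ (suc n C j) · v j
    ∎
  where
  shifted unshifted : Term
  shifted   = ∑[ j < n ] ℕ→ℚ (n C j) · v (suc j)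
  unshifted = ∑[ j < n ] ℕ→ℚ (n C suc j) · v (suc j)
  [nCn]·vn≈vn : ℕ→ℚ (n C n) · v n ≈ v n
  [nCn]·vn≈vn = ≈-trans (reflexive (cong (λ k → ℕ→ℚ k · v n) (nCn≡1 n))) (·-one (v n))
  pascal : ∀ j → j < n →
    ℕ→ℚ (suc n C suc j) · v (suc j) ≈ ℕ→ℚ (n C j) · v (suc j) ⊕ ℕ→ℚ (n C suc j) · v (suc j)
  pascal j _ = ≈-trans
    (reflexive (cong (_· v (suc j)) (trans (cong ℕ→ℚ (sym (nCk+nC[k+1]≡[n+1]C[k+1] n j))) (ℕ→ℚ-+ (n C j) (n C suc j)))))
    (·-distʳ (ℕ→ℚ (n C j)) (ℕ→ℚ (n C suc j)) (v (suc j)))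

D-·ˡ : ∀ r g x → D (r · g) x ≈ r · D g x
D-·ˡ r g gen-a       = br-·ˡ r g gen-a
D-·ˡ r g gen-b       = ≈-sym (·-𝟘 r)
D-·ˡ r g 𝟘           = ≈-sym (·-𝟘 r)
D-·ˡ r g (x ⊕ y)     = ≈-trans (⊕-cong (D-·ˡ r g x) (D-·ˡ r g y)) (≈-sym (·-distˡ r _ _))
D-·ˡ r g (s · x)     = ≈-trans (·-cong (D-·ˡ r g x)) (·-comm s r _)
D-·ˡ r g ⁅ x , y ⁆   = ≈-trans
  (⊕-cong (≈-trans (br-cong (D-·ˡ r g x) ≈-refl) (br-·ˡ r _ y))
          (≈-trans (br-cong ≈-refl (D-·ˡ r g y)) (br-·ʳ r x _)))
  (≈-sym (·-distˡ r _ _))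

ψ : ℕ → Term
ψ m = adaPow m gen-b

-- φ (suc m) is definitionally 1/fact m · ψ m.
1/fact : ℕ → ℚ
1/fact m = (+ 1 / m !) {{m !≢0}}

D-ψ : ∀ N P → D (ψ N) (ψ P) ≈ ∑[ j < P ] ℕ→ℚ (P C j) · ⁅ ψ j , ψ (N + P ∸ j) ⁆
D-ψ N zero    = ≈-refl
D-ψ N (suc P) = begin
  ⁅ ⁅ ψ N , gen-a ⁆ , ψ P ⁆ ⊕ ⁅ gen-a , D (ψ N) (ψ P) ⁆
    ≈⟨ ⊕-cong new-term (≈-trans (br-cong ≈-refl (D-ψ N P)) (br-∑ gen-a P _)) ⟩
  v P ⊕ ∑[ j < P ] ⁅ gen-a , ℕ→ℚ (P C j) · ⁅ ψ j , ψ (N + P ∸ j) ⁆ ⁆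
    ≈⟨ ⊕-cong ≈-refl (∑-cong P ad-term) ⟩
  v P ⊕ ∑[ j < P ] ℕ→ℚ (P C j) · (v (suc j) ⊕ v j)
    ≈⟨ ⊕-comm _ _ ⟩
  ∑[ j < P ] ℕ→ℚ (P C j) · (v (suc j) ⊕ v j) ⊕ v P
    ≈⟨ ∑-pascal P v ⟩
  ∑[ j < suc P ] ℕ→ℚ (suc P C j) · v j
    ∎
  where
  v : ℕ → Term
  v j = ⁅ ψ j , ψ (N + suc P ∸ j) ⁆
  new-term : ⁅ ⁅ ψ N , gen-a ⁆ , ψ P ⁆ ≈ v P
  new-term = ≈-trans (⁅⁅x,y⁆,z⁆≈⁅z,⁅y,x⁆⁆ (ψ N) gen-a (ψ P))
    (reflexive (cong (λ k → ⁅ ψ P , ψ k ⁆) (sym (trans (+-suc-∸ N P ≤-refl) (cong suc (m+n∸n≡m N P))))))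
  ad-term : ∀ j → j < P →
    ⁅ gen-a , ℕ→ℚ (P C j) · ⁅ ψ j , ψ (N + P ∸ j) ⁆ ⁆ ≈ ℕ→ℚ (P C j) · (v (suc j) ⊕ v j)
  ad-term j j<P = ≈-trans (br-·ʳ _ gen-a _) (·-cong (≈-trans (br-leibniz gen-a (ψ j) (ψ (N + P ∸ j)))
    (reflexive (cong₂ (λ k l → ⁅ ψ (suc j) , ψ k ⁆ ⊕ ⁅ ψ j , ψ l ⁆)
      (sym (cong (_∸ suc j) (+-suc N P))) (sym (+-suc-∸ N P (<⇒≤ j<P)))))))

ψ-term≈φ-term : ∀ N P {j} → j ≤ P →
  1/fact P · (1/fact N · (ℕ→ℚ (P C j) · ⁅ ψ j , ψ (N + P ∸ j) ⁆))
    ≈ ℕ→ℚ ((N + suc P ∸ suc j) C (P ∸ j)) · ⁅ φ (suc j) , φ (N + suc P ∸ j) ⁆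
ψ-term≈φ-term N P {j} j≤P = begin
  1/fact P · (1/fact N · (ℕ→ℚ (P C j) · w))
    ≈⟨ ≈-trans (·-assoc _ _ _) (·-cong (·-assoc _ _ _)) ⟨
  (1/fact P ℚ.* (1/fact N ℚ.* ℕ→ℚ (P C j))) · w
    ≡⟨ cong (_· w) (/-exchange (P C j) (K C (P ∸ j)) (P !) (N !) (j !) (K !)
                     {{P !≢0}} {{N !≢0}} {{j !≢0}} {{K !≢0}} (binomial-factorial-exchange N j≤P)) ⟩
  (ℕ→ℚ (K C (P ∸ j)) ℚ.* (1/fact j ℚ.* 1/fact K)) · w
    ≈⟨ ·-assoc _ _ _ ⟩
  ℕ→ℚ (K C (P ∸ j)) · ((1/fact j ℚ.* 1/fact K) · w)
    ≈⟨ ·-cong (br-·ˡʳ (1/fact j) (1/fact K) (ψ j) (ψ K)) ⟨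
  ℕ→ℚ (K C (P ∸ j)) · ⁅ φ (suc j) , φ (suc K) ⁆
    ≡⟨ cong₂ (λ k l → ℕ→ℚ (k C (P ∸ j)) · ⁅ φ (suc j) , φ l ⁆)
             (sym (cong (_∸ suc j) (+-suc N P))) (sym (+-suc-∸ N P j≤P)) ⟩
  ℕ→ℚ ((N + suc P ∸ suc j) C (P ∸ j)) · ⁅ φ (suc j) , φ (N + suc P ∸ j) ⁆
    ∎
  where
  K = N + P ∸ j
  w = ⁅ ψ j , ψ K ⁆

mainTheorem1 : (n p : ℕ) → 1 ≤ n → 1 ≤ p →
    D (φ n) (φ p) ≈ Σ1 (p ∸ 1) (λ k → ℕ→ℚ ((n + p ∸ 1 ∸ k) C (p ∸ k)) · ⁅ φ k , φ (n + p ∸ k) ⁆)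
mainTheorem1 (suc N) (suc P) (s≤s z≤n) (s≤s z≤n) = begin
  1/fact P · D (1/fact N · ψ N) (ψ P)             ≈⟨ ·-cong (D-·ˡ (1/fact N) (ψ N) (ψ P)) ⟩
  1/fact P · (1/fact N · D (ψ N) (ψ P))            ≈⟨ ·-cong (·-cong (D-ψ N P)) ⟩
  1/fact P · (1/fact N · (∑[ j < P ] f j))         ≈⟨ ·-cong (·-∑ (1/fact N) P f) ⟩
  1/fact P · (∑[ j < P ] 1/fact N · f j)           ≈⟨ ·-∑ (1/fact P) P _ ⟩
  ∑[ j < P ] 1/fact P · (1/fact N · f j)           ≈⟨ ∑-cong P (λ j j<P → ψ-term≈φ-term N P (<⇒≤ j<P)) ⟩
  ∑[ j < P ] t (suc j)                             ≡⟨ Σ1≡∑ P t ⟨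
  Σ1 P t                                           ∎
  where
  f : ℕ → Term
  f j = ℕ→ℚ (P C j) · ⁅ ψ j , ψ (N + P ∸ j) ⁆
  t : ℕ → Term
  t k = ℕ→ℚ ((suc N + suc P ∸ 1 ∸ k) C (suc P ∸ k)) · ⁅ φ k , φ (suc N + suc P ∸ k) ⁆
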